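{- If a finite group $\mathbf G$ has an element whose order equals the exponent of $\mathbf G$, then $\mathcal G_e(\mathbf G)$ is weakly perfect, i.e. $\chi(\mathcal G_e(\mathbf G))=\omega(\mathcal G_e(\mathbf G))$.
   Context: The enhanced power graph $\mathcal G_e(\mathbf G)$ of a group $\mathbf G$ is the simple graph on $G$ in which distinct $x,y$ are adjacent iff there is $z\in G$ with $x,y\in\langle z\rangle$. $\chi$ is the chromatic number and $\omega$ the clique number of a graph. -}

module Defs where

open import Level using (0ℓ)
open import Data.Nat using (ℕ; zero; suc; _≤_; _<_)
open import Data.Integer using (ℤ; +_; -[1+_])
open import Data.Fin using (Fin)
open import Data.Product using (Σ; ∃; ∃-syntax; _×_)
open import Relation.Binary.PropositionalEquality using (_≡_; _≢_)
open import Algebra.Core using (Op₁; Op₂)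
open import Algebra.Structures using (IsGroup)

-- A finite group: carrier Fin n (every finite group is isomorphic to
-- one of this form), group laws from the library's IsGroup w.r.t. ≡.

record FiniteGroup : Set where
  field
    size    : ℕ
    _∙_     : Op₂ (Fin size)
    ε       : Fin size
    _⁻¹     : Op₁ (Fin size)
    isGroup : IsGroup _≡_ _∙_ ε _⁻¹

module _ (G : FiniteGroup) where
  open FiniteGroup G

  Elt : Set
  Elt = Fin size

  pow : Elt → ℕ → Elt
  pow x zero    = ε
  pow x (suc k) = x ∙ pow x k

  zpow : Elt → ℤ → Elt
  zpow x (+ k)     = pow x k
  zpow x -[1+ k ]  = (pow x (suc k)) ⁻¹

  _∈⟨_⟩ : Elt → Elt → Set
  x ∈⟨ z ⟩ = ∃[ k ] zpow z k ≡ x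

  IsOrder : Elt → ℕ → Set
  IsOrder x k = 0 < k × pow x k ≡ ε × (∀ j → 0 < j → pow x j ≡ ε → k ≤ j)

  IsExponent : ℕ → Set
  IsExponent m = 0 < m × (∀ x → pow x m ≡ ε)
               × (∀ j → 0 < j → (∀ x → pow x j ≡ ε) → m ≤ j)

  EnhPowAdj : Elt → Elt → Set
  EnhPowAdj x y = x ≢ y × ∃[ z ] (x ∈⟨ z ⟩ × y ∈⟨ z ⟩)

module _ {n : ℕ} (Adj : Fin n → Fin n → Set) where

  Colorable : ℕ → Set
  Colorable k = Σ (Fin n → Fin k) λ c → ∀ x y → Adj x y → c x ≢ c y

  HasClique : ℕ → Set
  HasClique k = Σ (Fin k → Fin n) λ f → ∀ i j → i ≢ j → Adj (f i) (f j)

  IsChromaticNumber : ℕ → Set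
  IsChromaticNumber k = Colorable k × (∀ j → Colorable j → k ≤ j)

  IsCliqueNumber : ℕ → Set
  IsCliqueNumber k = HasClique k × (∀ j → HasClique j → j ≤ k)

  WeaklyPerfect : Set
  WeaklyPerfect = ∃[ k ] (IsChromaticNumber k × IsCliqueNumber k)

-- An element g of order m = exp G spans the clique ⟨g⟩ of size m, so it
-- remains to colour the enhanced power graph with m colours.  Write each x as
-- c ^ k, where c is a canonical generator of ⟨x⟩ (the first one in the
-- enumeration of G) and k is a unit modulo ord x, and colour x by the reduced
-- fraction k / ord x, encoded as (m / ord x) · k < m.  Adjacent vertices lie in
-- a common cyclic group; there equal reduced fractions force equal orders,
-- elements of equal order generate the same subgroup, and so both vertices are
-- the same power of the same canonical generator.

module Submission where

open import Level using (0ℓ)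
open import Function using (_∘_)
open import Data.Product using (∃; ∃-syntax; _×_; _,_; proj₁; proj₂)
open import Data.Nat using (ℕ; zero; suc; pred; _+_; _*_; _∸_; _≤_; _<_; z≤n; s≤s; NonZero; >-nonZero; ≢-nonZero)
open import Data.Nat.Properties
  using (<-cmp; ≮⇒≥; <⇒≱; <⇒≤; ≤-reflexive; ≤-antisym; ≤-<-trans; n≢0⇒n>0; m∸n≤m; m<n⇒0<n∸m;
         m+[n∸m]≡n; suc-pred; *-comm; *-assoc; [m*n]*[o*p]≡[m*o]*[n*p]; *-identityʳ; *-zeroʳ;
         *-cancelˡ-≡; *-cancelʳ-≡; *-cancelˡ-≤; *-monoʳ-<)
  renaming (_≟_ to _≟ℕ_)
open import Data.Nat.DivMod using (_%_; _/_; m≡m%n+[m/n]*n; m%n<n)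
open import Data.Nat.Divisibility
  using (_∣_; divides; quotient; quotient≢0; m∣n⇒n≡quotient*m; m%n≡0⇒n∣m; ∣-antisym; *-cancelʳ-∣)
open import Data.Nat.Coprimality using (Coprime; coprime-Bézout; coprime-divisor) renaming (sym to coprime-sym)
open import Data.Nat.GCD using (module Bézout)
open import Data.Integer using (+_; -[1+_])
open import Data.Fin using (Fin; toℕ; fromℕ<; _≟_)
open import Data.Fin.Properties using (toℕ-injective; toℕ<n; toℕ-fromℕ<; injective⇒≤; any?)
open import Relation.Nullary using (¬_; Dec; yes; no; contradiction)
open import Relation.Nullary.Decidable using (decidable-stable; _×-dec_; map′)
open import Relation.Unary using (Pred; Decidable; _⊆_; _≐_)
open import Relation.Binary.PropositionalEquality
open import Relation.Binary.Definitions using (tri<; tri≈; tri>)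
open import Algebra.Bundles using (Group)
import Algebra.Properties.Group as GroupProperties
import Algebra.Properties.Monoid.Mult as MonoidMult
open import Defs

Least : Pred ℕ 0ℓ → Pred ℕ 0ℓ
Least P k = P k × (∀ {j} → j < k → ¬ P j)

least : ∀ {P : Pred ℕ 0ℓ} → Decidable P → ∀ {n} → P n → ∃ (Least P)
least P? {zero} p = 0 , p , λ ()
least P? {suc n} p with P? 0
... | yes p₀ = 0 , p₀ , λ ()
... | no ¬p₀ with least (P? ∘ suc) p
...   | k , pk , below = suc k , pk , λ { {zero} _ → ¬p₀ ; {suc j} (s≤s j<k) → below j<k }

Least-unique : ∀ {P Q : Pred ℕ 0ℓ} → P ≐ Q → ∀ {k l} → Least P k → Least Q l → k ≡ l
Least-unique (P⊆Q , Q⊆P) {k} {l} (pk , belowk) (ql , belowl) with <-cmp k l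
... | tri< k<l _ _ = contradiction (P⊆Q pk) (belowl k<l)
... | tri≈ _ k≡l _ = k≡l
... | tri> _ _ l<k = contradiction (Q⊆P ql) (belowk l<k)

cross-multiply : ∀ {n a b d e k l} .{{_ : NonZero n}} →
                 n ≡ a * d → n ≡ b * e → a * k ≡ b * l → k * e ≡ l * d
cross-multiply {n} {a} {b} {d} {e} {k} {l} n≡a*d n≡b*e a*k≡b*l = *-cancelˡ-≡ (k * e) (l * d) n (begin
  n * (k * e)        ≡⟨ cong (_* (k * e)) n≡a*d ⟩
  a * d * (k * e)    ≡⟨ [m*n]*[o*p]≡[m*o]*[n*p] a d k e ⟩
  a * k * (d * e)    ≡⟨ cong (_* (d * e)) a*k≡b*l ⟩
  b * l * (d * e)    ≡⟨ cong (b * l *_) (*-comm d e) ⟩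
  b * l * (e * d)    ≡⟨ [m*n]*[o*p]≡[m*o]*[n*p] b e l d ⟨
  b * e * (l * d)    ≡⟨ cong (_* (l * d)) n≡b*e ⟨
  n * (l * d)        ∎)
  where open ≡-Reasoning

coprime-fractions-equal : ∀ {k d l e} .{{_ : NonZero d}} →
                          Coprime k d → Coprime l e → k * e ≡ l * d → d ≡ e × k ≡ l
coprime-fractions-equal {k} {d} {l} {e} k⊥d l⊥e k*e≡l*d = d≡e , k≡l
  where
  d≡e : d ≡ e
  d≡e = ∣-antisym (coprime-divisor (coprime-sym k⊥d) (divides l k*e≡l*d))
                  (coprime-divisor (coprime-sym l⊥e) (divides k (sym k*e≡l*d)))
  k≡l : k ≡ l
  k≡l = *-cancelʳ-≡ k l d (trans (cong (k *_) d≡e) k*e≡l*d)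

module _ {n : ℕ} {Adj : Fin n → Fin n → Set} where

  clique≤colours : ∀ {j k} → HasClique Adj j → Colorable Adj k → j ≤ k
  clique≤colours (f , adjacent) (c , proper) = injective⇒≤ {f = c ∘ f} injective
    where
    injective : ∀ {i i′} → c (f i) ≡ c (f i′) → i ≡ i′
    injective {i} {i′} same = decidable-stable (i ≟ i′) λ i≢i′ → proper _ _ (adjacent i i′ i≢i′) same

  weaklyPerfect : ∀ {k} → HasClique Adj k → Colorable Adj k → WeaklyPerfect Adj
  weaklyPerfect clique colouring =
    _ , (colouring , λ _ other → clique≤colours clique other)
      , (clique , λ _ other → clique≤colours other colouring)

module Powers (G : FiniteGroup) where
  open FiniteGroup G

  group : Group 0ℓ 0ℓ
  group = record { Carrier = Elt G ; _≈_ = _≡_ ; _∙_ = _∙_ ; ε = ε ; _⁻¹ = _⁻¹ ; isGroup = isGroup }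

  open Group group using (identityˡ; identityʳ; monoid)
  open GroupProperties group using (∙-cancelˡ; inverseˡ-unique; inverseʳ-unique)
  open MonoidMult monoid using (×-homo-+; ×-assocˡ) renaming (_×_ to _·_)

  infixl 30 _^_
  _^_ : Elt G → ℕ → Elt G
  x ^ n = pow G x n

  infix 4 _∈ₙ⟨_⟩
  _∈ₙ⟨_⟩ : Elt G → Elt G → Set
  x ∈ₙ⟨ z ⟩ = ∃[ k ] z ^ k ≡ x

  ^≡× : ∀ x n → x ^ n ≡ n · x
  ^≡× x zero    = refl
  ^≡× x (suc n) = cong (x ∙_) (^≡× x n)

  ^-+ : ∀ x a b → x ^ (a + b) ≡ x ^ a ∙ x ^ b
  ^-+ x a b = begin
    x ^ (a + b)       ≡⟨ ^≡× x (a + b) ⟩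
    (a + b) · x       ≡⟨ ×-homo-+ x a b ⟩
    (a · x) ∙ (b · x) ≡⟨ cong₂ _∙_ (^≡× x a) (^≡× x b) ⟨
    x ^ a ∙ x ^ b     ∎
    where open ≡-Reasoning

  ^-* : ∀ x a b → (x ^ a) ^ b ≡ x ^ (a * b)
  ^-* x a b = begin
    (x ^ a) ^ b     ≡⟨ ^≡× (x ^ a) b ⟩
    b · (x ^ a)     ≡⟨ cong (b ·_) (^≡× x a) ⟩
    b · (a · x)     ≡⟨ ×-assocˡ x b a ⟩
    (b * a) · x     ≡⟨ ^≡× x (b * a) ⟨
    x ^ (b * a)     ≡⟨ cong (x ^_) (*-comm b a) ⟩
    x ^ (a * b)     ∎
    where open ≡-Reasoning

  ε^ : ∀ n → ε ^ n ≡ ε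
  ε^ zero    = refl
  ε^ (suc n) = trans (identityˡ _) (ε^ n)

  ^≡ε⇒^*≡ε : ∀ {x d} q → x ^ d ≡ ε → x ^ (q * d) ≡ ε
  ^≡ε⇒^*≡ε {x} {d} q x^d≡ε = begin
    x ^ (q * d)   ≡⟨ cong (x ^_) (*-comm q d) ⟩
    x ^ (d * q)   ≡⟨ ^-* x d q ⟨
    (x ^ d) ^ q   ≡⟨ cong (_^ q) x^d≡ε ⟩
    ε ^ q         ≡⟨ ε^ q ⟩
    ε             ∎
    where open ≡-Reasoning

  ^-% : ∀ {x d} .{{_ : NonZero d}} → x ^ d ≡ ε → ∀ a → x ^ (a % d) ≡ x ^ a
  ^-% {x} {d} x^d≡ε a = begin
    x ^ (a % d)                     ≡⟨ identityʳ _ ⟨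
    x ^ (a % d) ∙ ε                 ≡⟨ cong (x ^ (a % d) ∙_) (^≡ε⇒^*≡ε {x} {d} (a / d) x^d≡ε) ⟨
    x ^ (a % d) ∙ x ^ (a / d * d)   ≡⟨ ^-+ x (a % d) _ ⟨
    x ^ (a % d + a / d * d)         ≡⟨ cong (x ^_) (m≡m%n+[m/n]*n a d) ⟨
    x ^ a                           ∎
    where open ≡-Reasoning

  ⁻¹-∈ₙ : ∀ {x n} .{{_ : NonZero n}} → x ^ n ≡ ε → x ⁻¹ ∈ₙ⟨ x ⟩
  ⁻¹-∈ₙ {x} {n} x^n≡ε = pred n , inverseʳ-unique x (x ^ pred n) x^n≡ε′
    where
    x^n≡ε′ : x ^ suc (pred n) ≡ ε
    x^n≡ε′ = subst (λ k → x ^ k ≡ ε) (sym (suc-pred n)) x^n≡ε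

  ∈ₙ-refl : ∀ x → x ∈ₙ⟨ x ⟩
  ∈ₙ-refl x = 1 , identityʳ x

  ∈ₙ-trans : ∀ {x y z} → x ∈ₙ⟨ y ⟩ → y ∈ₙ⟨ z ⟩ → x ∈ₙ⟨ z ⟩
  ∈ₙ-trans {z = z} (a , refl) (b , refl) = b * a , sym (^-* z b a)

  ∈ₙ-^≡ε : ∀ {x z n} → x ∈ₙ⟨ z ⟩ → z ^ n ≡ ε → x ^ n ≡ ε
  ∈ₙ-^≡ε {z = z} {n} (k , refl) z^n≡ε = trans (^-* z k n) (^≡ε⇒^*≡ε {z} {n} k z^n≡ε)

  order-divides : ∀ {x d j} → IsOrder G x d → x ^ j ≡ ε → d ∣ j
  order-divides {x} {d} {j} (d>0 , x^d≡ε , minimal) x^j≡ε = m%n≡0⇒n∣m j d remainder≡0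
    where
    instance
      d≢0 : NonZero d
      d≢0 = >-nonZero d>0
    remainder≡0 : j % d ≡ 0
    remainder≡0 = decidable-stable (j % d ≟ℕ 0) λ r≢0 →
      <⇒≱ (m%n<n j d) (minimal (j % d) (n≢0⇒n>0 r≢0) (trans (^-% x^d≡ε j) x^j≡ε))

  ^-distinct-below-order : ∀ {x d a b} → IsOrder G x d → a < b → b < d → x ^ a ≢ x ^ b
  ^-distinct-below-order {x} {d} {a} {b} (_ , _ , minimal) a<b b<d x^a≡x^b =
    <⇒≱ (≤-<-trans (m∸n≤m b a) b<d) (minimal (b ∸ a) (m<n⇒0<n∸m a<b) x^[b∸a]≡ε)
    where
    open ≡-Reasoning
    x^[b∸a]≡ε : x ^ (b ∸ a) ≡ ε
    x^[b∸a]≡ε = sym (∙-cancelˡ (x ^ a) ε (x ^ (b ∸ a)) (begin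
      x ^ a ∙ ε           ≡⟨ identityʳ _ ⟩
      x ^ a               ≡⟨ x^a≡x^b ⟩
      x ^ b               ≡⟨ cong (x ^_) (m+[n∸m]≡n (<⇒≤ a<b)) ⟨
      x ^ (a + (b ∸ a))   ≡⟨ ^-+ x a (b ∸ a) ⟩
      x ^ a ∙ x ^ (b ∸ a) ∎))

  ^-injective-below-order : ∀ {x d i j} → IsOrder G x d → i < d → j < d → x ^ i ≡ x ^ j → i ≡ j
  ^-injective-below-order {i = i} {j} order i<d j<d x^i≡x^j with <-cmp i j
  ... | tri< i<j _ _ = contradiction x^i≡x^j (^-distinct-below-order order i<j j<d)
  ... | tri≈ _ i≡j _ = i≡j
  ... | tri> _ _ j<i = contradiction (sym x^i≡x^j) (^-distinct-below-order order j<i i<d)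

  order-coprime : ∀ {w d a} → w ^ d ≡ ε → IsOrder G (w ^ a) d → Coprime a d
  order-coprime {w} {d} {a} w^d≡ε (d>0 , _ , minimal) {i} (divides a′ a≡a′*i , i∣d) =
    ≤-antisym i≤1 (n≢0⇒n>0 i≢0)
    where
    open ≡-Reasoning
    q : ℕ
    q = quotient i∣d
    d≡q*i : d ≡ q * i
    d≡q*i = m∣n⇒n≡quotient*m i∣d
    [w^a]^q≡ε : (w ^ a) ^ q ≡ ε
    [w^a]^q≡ε = begin
      (w ^ a) ^ q         ≡⟨ ^-* w a q ⟩
      w ^ (a * q)         ≡⟨ cong (λ t → w ^ (t * q)) a≡a′*i ⟩
      w ^ (a′ * i * q)    ≡⟨ cong (w ^_) (*-assoc a′ i q) ⟩
      w ^ (a′ * (i * q))  ≡⟨ cong (λ t → w ^ (a′ * t)) (trans (*-comm i q) (sym d≡q*i)) ⟩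
      w ^ (a′ * d)        ≡⟨ ^≡ε⇒^*≡ε {w} {d} a′ w^d≡ε ⟩
      ε                   ∎
    q≢0 : q ≢ 0
    q≢0 q≡0 = <⇒≱ d>0 (≤-reflexive (trans d≡q*i (cong (_* i) q≡0)))
    i≢0 : i ≢ 0
    i≢0 i≡0 = <⇒≱ d>0 (≤-reflexive (trans d≡q*i (trans (cong (q *_) i≡0) (*-zeroʳ q))))
    instance
      q-nonZero : NonZero q
      q-nonZero = ≢-nonZero q≢0
    i≤1 : i ≤ 1
    i≤1 = *-cancelˡ-≤ q (subst₂ _≤_ d≡q*i (sym (*-identityʳ q)) (minimal q (n≢0⇒n>0 q≢0) [w^a]^q≡ε))

  generator-of-full-order : ∀ {w x d} → w ^ d ≡ ε → x ∈ₙ⟨ w ⟩ → IsOrder G x d → w ∈ₙ⟨ x ⟩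
  generator-of-full-order {w} {_} {d} w^d≡ε (p , refl) order@(d>0 , _)
    with coprime-Bézout (order-coprime w^d≡ε order)
  ... | Bézout.+- u v 1+v*d≡u*p = u , (begin
    (w ^ p) ^ u          ≡⟨ ^-* w p u ⟩
    w ^ (p * u)          ≡⟨ cong (w ^_) (trans (*-comm p u) (sym 1+v*d≡u*p)) ⟩
    w ^ (1 + v * d)      ≡⟨ ^-+ w 1 (v * d) ⟩
    w ^ 1 ∙ w ^ (v * d)  ≡⟨ cong₂ _∙_ (identityʳ w) (^≡ε⇒^*≡ε {w} {d} v w^d≡ε) ⟩
    w ∙ ε                ≡⟨ identityʳ w ⟩
    w                    ∎)
    where open ≡-Reasoning
  ... | Bézout.-+ u v 1+u*p≡v*d = subst (_∈ₙ⟨ w ^ p ⟩) (sym w≡y⁻¹) (∈ₙ-trans (⁻¹-∈ₙ y^d≡ε) (u , refl))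
    where
    open ≡-Reasoning
    instance
      d-nonZero : NonZero d
      d-nonZero = >-nonZero d>0
    y : Elt G
    y = (w ^ p) ^ u
    y^d≡ε : y ^ d ≡ ε
    y^d≡ε = ∈ₙ-^≡ε {z = w ^ p} {d} (u , refl) (∈ₙ-^≡ε {z = w} {d} (p , refl) w^d≡ε)
    w≡y⁻¹ : w ≡ y ⁻¹
    w≡y⁻¹ = inverseˡ-unique w y (begin
      w ∙ (w ^ p) ^ u      ≡⟨ cong₂ _∙_ (sym (identityʳ w)) (^-* w p u) ⟩
      w ^ 1 ∙ w ^ (p * u)  ≡⟨ ^-+ w 1 (p * u) ⟨
      w ^ (1 + p * u)      ≡⟨ cong (λ t → w ^ (1 + t)) (*-comm p u) ⟩
      w ^ (1 + u * p)      ≡⟨ cong (w ^_) 1+u*p≡v*d ⟩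
      w ^ (v * d)          ≡⟨ ^≡ε⇒^*≡ε {w} {d} v w^d≡ε ⟩
      ε                    ∎)

  powers-clique : ∀ {g m} → IsOrder G g m → HasClique (EnhPowAdj G) m
  powers-clique {g} g-order = (λ i → g ^ toℕ i) , λ i j i≢j →
    (i≢j ∘ toℕ-injective ∘ ^-injective-below-order g-order (toℕ<n i) (toℕ<n j))
    , g , (+ toℕ i , refl) , (+ toℕ j , refl)

module Period (G : FiniteGroup) (m : ℕ) .{{_ : NonZero m}}
              (period : ∀ x → pow G x m ≡ FiniteGroup.ε G) where
  open FiniteGroup G
  open Powers G

  ∈⟨⟩⇒∈ₙ⟨⟩ : ∀ {x z} → _∈⟨_⟩ G x z → x ∈ₙ⟨ z ⟩
  ∈⟨⟩⇒∈ₙ⟨⟩ (+ k , z^k≡x)   = k , z^k≡x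
  ∈⟨⟩⇒∈ₙ⟨⟩ {z = z} (-[1+ k ] , refl) = ∈ₙ-trans (⁻¹-∈ₙ {n = m} (period (z ^ suc k))) (suc k , refl)

  _∈ₙ?_ : ∀ y z → Dec (y ∈ₙ⟨ z ⟩)
  y ∈ₙ? z = map′ (λ (i , z^i≡y) → toℕ i , z^i≡y) below-m (any? λ i → z ^ toℕ i ≟ y)
    where
    below-m : y ∈ₙ⟨ z ⟩ → ∃[ i ] z ^ toℕ i ≡ y
    below-m (k , z^k≡y) = fromℕ< (m%n<n k m) ,
      trans (cong (z ^_) (toℕ-fromℕ< (m%n<n k m))) (trans (^-% (period z) k) z^k≡y)

  firstPeriod : ∀ x → ∃ (Least λ j → x ^ suc j ≡ ε)
  firstPeriod x = least (λ j → x ^ suc j ≟ ε) {pred m}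
                        (subst (λ k → x ^ k ≡ ε) (sym (suc-pred m)) (period x))

  ord : Elt G → ℕ
  ord x = suc (proj₁ (firstPeriod x))

  ord-isOrder : ∀ x → IsOrder G x (ord x)
  ord-isOrder x = s≤s z≤n , proj₁ (proj₂ (firstPeriod x)) , minimal
    where
    minimal : ∀ j → 0 < j → x ^ j ≡ ε → ord x ≤ j
    minimal (suc j) _ x^j+1≡ε = s≤s (≮⇒≥ λ j<k → proj₂ (proj₂ (firstPeriod x)) j<k x^j+1≡ε)

  ord^≡ε : ∀ x → x ^ ord x ≡ ε
  ord^≡ε x = proj₁ (proj₂ (ord-isOrder x))

  ∈ₙ-of-torsion : ∀ {y z e d} .{{_ : NonZero d}} → ord z ≡ e * d → y ∈ₙ⟨ z ⟩ → y ^ d ≡ ε → y ∈ₙ⟨ z ^ e ⟩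
  ∈ₙ-of-torsion {z = z} {e} {d} ord≡e*d (b , refl) y^d≡ε = q , (begin
    (z ^ e) ^ q   ≡⟨ ^-* z e q ⟩
    z ^ (e * q)   ≡⟨ cong (z ^_) (trans (*-comm e q) (sym b≡q*e)) ⟩
    z ^ b         ∎)
    where
    open ≡-Reasoning
    e∣b : e ∣ b
    e∣b = *-cancelʳ-∣ d (subst (_∣ b * d) ord≡e*d
                          (order-divides (ord-isOrder z) (trans (sym (^-* z b d)) y^d≡ε)))
    q : ℕ
    q = quotient e∣b
    b≡q*e : b ≡ q * e
    b≡q*e = m∣n⇒n≡quotient*m e∣b

  same-order⇒∈ₙ : ∀ {x y z d} → x ∈ₙ⟨ z ⟩ → y ∈ₙ⟨ z ⟩ → IsOrder G x d → IsOrder G y d → y ∈ₙ⟨ x ⟩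
  same-order⇒∈ₙ {x} {y} {z} {d} x∈⟨z⟩ y∈⟨z⟩ x-order@(d>0 , x^d≡ε , _) (_ , y^d≡ε , _) =
    ∈ₙ-trans (∈ₙ-of-torsion {e = e} {d} ord≡e*d y∈⟨z⟩ y^d≡ε)
             (generator-of-full-order {d = d} [z^e]^d≡ε
                (∈ₙ-of-torsion {e = e} {d} ord≡e*d x∈⟨z⟩ x^d≡ε) x-order)
    where
    instance
      d-nonZero : NonZero d
      d-nonZero = >-nonZero d>0
    d∣ord : d ∣ ord z
    d∣ord = order-divides x-order (∈ₙ-^≡ε {n = ord z} x∈⟨z⟩ (ord^≡ε z))
    e : ℕ
    e = quotient d∣ord
    ord≡e*d : ord z ≡ e * d
    ord≡e*d = m∣n⇒n≡quotient*m d∣ord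
    [z^e]^d≡ε : (z ^ e) ^ d ≡ ε
    [z^e]^d≡ε = trans (^-* z e d) (trans (cong (z ^_) (sym ord≡e*d)) (ord^≡ε z))

  infix 4 _∼_
  _∼_ : Elt G → Elt G → Set
  x ∼ y = y ∈ₙ⟨ x ⟩ × x ∈ₙ⟨ y ⟩

  ∼-sym : ∀ {x y} → x ∼ y → y ∼ x
  ∼-sym (y∈⟨x⟩ , x∈⟨y⟩) = x∈⟨y⟩ , y∈⟨x⟩

  GeneratorIndex : Elt G → Pred ℕ 0ℓ
  GeneratorIndex x j = ∃[ c ] toℕ c ≡ j × x ∼ c

  GeneratorIndex-cong : ∀ {x y} → x ∼ y → GeneratorIndex x ⊆ GeneratorIndex y
  GeneratorIndex-cong (y∈⟨x⟩ , x∈⟨y⟩) (c , c≡j , c∈⟨x⟩ , x∈⟨c⟩) =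
    c , c≡j , ∈ₙ-trans c∈⟨x⟩ x∈⟨y⟩ , ∈ₙ-trans y∈⟨x⟩ x∈⟨c⟩

  firstGenerator : ∀ x → ∃ (Least (GeneratorIndex x))
  firstGenerator x = least (λ j → any? λ c → (toℕ c ≟ℕ j) ×-dec ((c ∈ₙ? x) ×-dec (x ∈ₙ? c)))
                           (x , refl , ∈ₙ-refl x , ∈ₙ-refl x)

  leastGenerator : ∀ x → GeneratorIndex x (proj₁ (firstGenerator x))
  leastGenerator x = proj₁ (proj₂ (firstGenerator x))

  canon : Elt G → Elt G
  canon x = proj₁ (leastGenerator x)

  canon-∼ : ∀ x → x ∼ canon x
  canon-∼ x = proj₂ (proj₂ (leastGenerator x))

  canon-cong : ∀ {x y} → x ∼ y → canon x ≡ canon y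
  canon-cong {x} {y} x∼y = toℕ-injective (begin
    toℕ (canon x)             ≡⟨ proj₁ (proj₂ (leastGenerator x)) ⟩
    proj₁ (firstGenerator x)  ≡⟨ Least-unique (GeneratorIndex-cong x∼y , GeneratorIndex-cong (∼-sym x∼y))
                                   (proj₂ (firstGenerator x)) (proj₂ (firstGenerator y)) ⟩
    proj₁ (firstGenerator y)  ≡⟨ proj₁ (proj₂ (leastGenerator y)) ⟨
    toℕ (canon y)             ∎)
    where open ≡-Reasoning

  ord∣m : ∀ x → ord x ∣ m
  ord∣m x = order-divides (ord-isOrder x) (period x)

  cofactor : Elt G → ℕ
  cofactor x = quotient (ord∣m x)

  m≡cofactor*ord : ∀ x → m ≡ cofactor x * ord x
  m≡cofactor*ord x = m∣n⇒n≡quotient*m (ord∣m x)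

  canon^ord≡ε : ∀ x → canon x ^ ord x ≡ ε
  canon^ord≡ε x = ∈ₙ-^≡ε {n = ord x} (proj₁ (canon-∼ x)) (ord^≡ε x)

  ∈ₙ⟨canon⟩ : ∀ x → x ∈ₙ⟨ canon x ⟩
  ∈ₙ⟨canon⟩ x = proj₂ (canon-∼ x)

  index : Elt G → ℕ
  index x = proj₁ (∈ₙ⟨canon⟩ x) % ord x

  canon^index : ∀ x → canon x ^ index x ≡ x
  canon^index x =
    trans (^-% {canon x} {ord x} (canon^ord≡ε x) (proj₁ (∈ₙ⟨canon⟩ x))) (proj₂ (∈ₙ⟨canon⟩ x))

  index-coprime : ∀ x → Coprime (index x) (ord x)
  index-coprime x = order-coprime (canon^ord≡ε x)
    (subst (λ t → IsOrder G t (ord x)) (sym (canon^index x)) (ord-isOrder x))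

  colour-value<m : ∀ x → cofactor x * index x < m
  colour-value<m x = subst (cofactor x * index x <_) (sym (m≡cofactor*ord x))
    (*-monoʳ-< (cofactor x) {{quotient≢0 (ord∣m x)}} (m%n<n (proj₁ (∈ₙ⟨canon⟩ x)) (ord x)))

  colour : Elt G → Fin m
  colour x = fromℕ< (colour-value<m x)

  colour-injective : ∀ {x y z} → x ∈ₙ⟨ z ⟩ → y ∈ₙ⟨ z ⟩ → colour x ≡ colour y → x ≡ y
  colour-injective {x} {y} x∈⟨z⟩ y∈⟨z⟩ same-colour = begin
    x                   ≡⟨ canon^index x ⟨
    canon x ^ index x   ≡⟨ cong₂ _^_ (canon-cong x∼y) (proj₂ fractions) ⟩
    canon y ^ index y   ≡⟨ canon^index y ⟩
    y                   ∎
    where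
    open ≡-Reasoning
    same-value : cofactor x * index x ≡ cofactor y * index y
    same-value = trans (sym (toℕ-fromℕ< _)) (trans (cong toℕ same-colour) (toℕ-fromℕ< _))
    fractions : ord x ≡ ord y × index x ≡ index y
    fractions = coprime-fractions-equal (index-coprime x) (index-coprime y)
                  (cross-multiply {a = cofactor x} {cofactor y} {ord x} {ord y} {index x} {index y}
                    (m≡cofactor*ord x) (m≡cofactor*ord y) same-value)
    y-order : IsOrder G y (ord x)
    y-order = subst (IsOrder G y) (sym (proj₁ fractions)) (ord-isOrder y)
    x∼y : x ∼ y
    x∼y = same-order⇒∈ₙ x∈⟨z⟩ y∈⟨z⟩ (ord-isOrder x) y-order
        , same-order⇒∈ₙ y∈⟨z⟩ x∈⟨z⟩ y-order (ord-isOrder x)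

  colouring : Colorable (EnhPowAdj G) m
  colouring = colour , λ x y (x≢y , z , x∈⟨z⟩ , y∈⟨z⟩) →
    x≢y ∘ colour-injective (∈⟨⟩⇒∈ₙ⟨⟩ x∈⟨z⟩) (∈⟨⟩⇒∈ₙ⟨⟩ y∈⟨z⟩)

mainTheorem20 : (G : FiniteGroup) →
    (∃[ x ] ∃[ m ] (IsExponent G m × IsOrder G x m)) →
    WeaklyPerfect (EnhPowAdj G)
mainTheorem20 G (g , m , (m>0 , period , _) , g-order) =
  weaklyPerfect (Powers.powers-clique G g-order) (Period.colouring G m {{>-nonZero m>0}} period)
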